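{- Let $\mathcal R=(R,\oplus,\le,0)$ be a distance magma and $S\subseteq R$ with $0\in S$. (a) For $\alpha,\beta,\gamma\in S^*$, $\gamma\in\Sigma(\alpha,\beta)$ if and only if $N_\Phi(\alpha,\beta,\gamma)\cap\Delta(S,\mathcal R)\neq\emptyset$ for every $S$-approximation $\Phi$ of $\{\alpha,\beta,\gamma\}$. (b) For $\alpha,\beta\in S^*$, $\max\{\alpha,\beta\}\in\Sigma(\alpha,\beta)$, and hence $\max\{\alpha,\beta\}\le^*\alpha\oplus^*\beta$.
   Context: A distance magma is a structure $(R,\oplus,\le,0)$ with $\oplus$ binary, $0\in R$, such that $\le$ is a total order, $r\le r\oplus s$, $r\le t,s\le u\Rightarrow r\oplus s\le t\oplus u$, $\oplus$ commutative, $0$ an identity. $(r,s,t)\in R^3$ is an $\mathcal R$-triangle if $r\le s\oplus t$, $s\le r\oplus t$, $t\le r\oplus s$; $\Delta(S,\mathcal R)$ is the set of $\mathcal R$-triangles in $S^3$. $\mathcal L_S$ has binary relation symbols $d(x,y)\le s$ ($s\in S$). $T_{\mathrm{MS}}(S,\mathcal R)$ is: $\forall x\forall y(d(x,y)\le0\leftrightarrow x=y)$; $\forall x\forall y(d(x,y)\le s\leftrightarrow d(y,x)\le s)$ for $s\in S$; for $r,s,t\in S$ with no $x\in S$ satisfying $t<x\le r\oplus s$, $\forall x\forall y\forall z((d(x,y)\le r\wedge d(y,z)\le s)\to d(x,z)\le t)$; if $S$ has a maximum $s$, $\forall x\forall y\,d(x,y)\le s$. A cut in $S$ is an upward-closed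 $X\subseteq S$ containing $\max S$ if it exists; $S^*$ is the set of cuts ordered by $X\le^*Y\iff Y\subseteq X$ (a complete linear order), with $r\in S$ identified with $\{x\in S:x\ge r\}$; $\omega_S$ is the maximum of $S^*$. For $\alpha\in S^*$, $p_\alpha(x,y)=\{d(x,y)\le s:\alpha\le^*s\}\cup\{\neg d(x,y)\le s:s<^*\alpha\}$ ($s\in S$). $\Sigma(\alpha,\beta)$ is the set of $\gamma\in S^*$ such that $T_{\mathrm{MS}}(S,\mathcal R)\cup p_\alpha(x,y)\cup p_\beta(y,z)\cup p_\gamma(x,z)$ is consistent, and $\alpha\oplus^*\beta=\sup\Sigma(\alpha,\beta)$. $\mathrm{Int}^*(S)$ is the set of subsets of $S^*$ of the form $\{0\}$ or $(r,s]=\{x\in S^*:r<^*x\le^*s\}$ with $r,s\in S\cup\{\omega_S\}$, $r<^*s$. An $S$-approximation of $X\subseteq S^*$ is a map $\Phi:X\to\mathrm{Int}^*(S)$ with $\alpha\in\Phi(\alpha)$ for all $\alpha\in X$; $N_\Phi(\alpha,\beta,\gamma)=\Phi(\alpha)\times\Phi(\beta)\times\Phi(\gamma)$. -}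

module Defs where

import Level
open import Level using (0ℓ; suc)
open import Data.Product using (Σ; _×_; _,_; proj₁; proj₂)
open import Relation.Nullary using (¬_)
open import Relation.Binary.PropositionalEquality using (_≡_)
open import Relation.Binary.Structures using (IsTotalOrder)

record DistanceMagma : Set₁ where
  infixl 6 _⊕_
  infix 4 _≤_
  field
    Carrier     : Set
    _⊕_         : Carrier → Carrier → Carrier
    _≤_         : Carrier → Carrier → Set
    0#          : Carrier
    isTotalOrder : IsTotalOrder _≡_ _≤_
    ≤-⊕         : ∀ r s → r ≤ r ⊕ s
    ⊕-mono      : ∀ {r s t u} → r ≤ t → s ≤ u → r ⊕ s ≤ t ⊕ u
    ⊕-comm      : ∀ r s → r ⊕ s ≡ s ⊕ r
    ⊕-identityˡ : ∀ r → 0# ⊕ r ≡ r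
    ⊕-identityʳ : ∀ r → r ⊕ 0# ≡ r

  _<_ : Carrier → Carrier → Set
  r < s = r ≤ s × ¬ (r ≡ s)

module Theory (𝓡 : DistanceMagma) (S : DistanceMagma.Carrier 𝓡 → Set) where
  open DistanceMagma 𝓡

  R : Set
  R = Carrier

  IsMaxS : R → Set
  IsMaxS m = S m × (∀ y → S y → y ≤ m)

  record Cut : Set₁ where
    field
      mem    : R → Set
      mem⊆S  : ∀ x → mem x → S x
      upward : ∀ x y → mem x → S y → x ≤ y → mem y
      hasMax : ∀ m → IsMaxS m → mem m
  open Cut public

  infix 4 _≤*_ _<*_ _≈*_
  _≤*_ : Cut → Cut → Set
  X ≤* Y = ∀ x → mem Y x → mem X x

  _<*_ : Cut → Cut → Set
  X <* Y = X ≤* Y × ¬ (Y ≤* X)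

  _≈*_ : Cut → Cut → Set
  X ≈* Y = X ≤* Y × Y ≤* X

  -- r ∈ S identified with the cut {x ∈ S : x ≥ r}
  ↑ : (r : R) → S r → Cut
  ↑ r sr = record
    { mem    = λ x → S x × r ≤ x
    ; mem⊆S  = λ x p → proj₁ p
    ; upward = λ x y p sy x≤y → sy , IsTotalOrder.trans isTotalOrder (proj₂ p) x≤y
    ; hasMax = λ m mm → proj₁ mm , proj₂ mm r sr
    }

  -- ω_S, the maximum of S* : the least cut {x ∈ S : x = max S}
  -- (empty if S has no maximum)
  ωS : Cut
  ωS = record
    { mem    = IsMaxS
    ; mem⊆S  = λ x p → proj₁ p
    ; upward = λ x y p sy x≤y →
        sy , λ z sz → IsTotalOrder.trans isTotalOrder (proj₂ p z sz) x≤y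
    ; hasMax = λ m mm → mm
    }

  IsSup* : ∀ {ℓ} → (Cut → Set ℓ) → Cut → Set (ℓ Level.⊔ suc 0ℓ)
  IsSup* P σ = (∀ γ → P γ → γ ≤* σ) × (∀ τ → (∀ γ → P γ → γ ≤* τ) → σ ≤* τ)

  -- Structures for the language 𝓛_S: a binary relation "d(x,y) ≤ s"
  -- for every s (only used for s ∈ S); equality is interpreted as ≡.

  record LStructure : Set₁ where
    field
      Dom : Set
      D   : R → Dom → Dom → Set

  record IsModel (𝓜 : LStructure) : Set where
    open LStructure 𝓜
    field
      ax-zero  : ∀ x y → (D 0# x y → x ≡ y) × (x ≡ y → D 0# x y)
      ax-symm  : ∀ s → S s → ∀ x y → (D s x y → D s y x) × (D s y x → D s x y)
      ax-tri   : ∀ r s t → S r → S s → S t →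
                 ¬ (Σ R λ x → S x × t < x × x ≤ r ⊕ s) →
                 ∀ x y z → D r x y → D s y z → D t x z
      ax-max   : ∀ m → IsMaxS m → ∀ x y → D m x y

  Realizes : (𝓜 : LStructure) → Cut → LStructure.Dom 𝓜 → LStructure.Dom 𝓜 → Set
  Realizes 𝓜 α x y = ∀ s (ss : S s) →
    (α ≤* ↑ s ss → LStructure.D 𝓜 s x y) × (↑ s ss <* α → ¬ LStructure.D 𝓜 s x y)

  -- γ ∈ Σ(α,β): T_MS ∪ p_α(x,y) ∪ p_β(y,z) ∪ p_γ(x,z) is consistent,
  -- read (via Gödel completeness) as: it has a model.
  InΣ : Cut → Cut → Cut → Set₁
  InΣ α β γ = Σ LStructure λ 𝓜 → IsModel 𝓜 ×
    Σ (LStructure.Dom 𝓜) λ x → Σ (LStructure.Dom 𝓜) λ y → Σ (LStructure.Dom 𝓜) λ z →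
      Realizes 𝓜 α x y × Realizes 𝓜 β y z × Realizes 𝓜 γ x z

  -- σ = α ⊕* β = sup Σ(α,β)  (S* is complete, so this determines σ up to ≈*)
  Is⊕* : Cut → Cut → Cut → Set₁
  Is⊕* α β σ = IsSup* (InΣ α β) σ

  data End : Set where
    fin : (r : R) → S r → End
    ω   : End

  ⟦_⟧E : End → Cut
  ⟦ fin r sr ⟧E = ↑ r sr
  ⟦ ω ⟧E = ωS

  data Int* : Set₁ where
    ｛0｝ : Int*
    oc  : (r s : End) → ⟦ r ⟧E <* ⟦ s ⟧E → Int*

  _∈I_ : Cut → Int* → Set
  α ∈I ｛0｝ = Σ (S 0#) λ s0 → α ≈* ↑ 0# s0
  α ∈I oc r s _ = ⟦ r ⟧E <* α × α ≤* ⟦ s ⟧E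

  _≐_ : Int* → Int* → Set₁
  I ≐ J = ∀ (x : Cut) → (x ∈I I → x ∈I J) × (x ∈I J → x ∈I I)

  -- an S-approximation Φ of the set {α, β, γ}: a map on this set, i.e. one
  -- interval for each of α, β, γ, equal intervals for equal cuts.
  record Approx (α β γ : Cut) : Set₁ where
    field
      Φα Φβ Φγ : Int*
      α∈ : α ∈I Φα
      β∈ : β ∈I Φβ
      γ∈ : γ ∈I Φγ
      coh-αβ : α ≈* β → Φα ≐ Φβ
      coh-αγ : α ≈* γ → Φα ≐ Φγ
      coh-βγ : β ≈* γ → Φβ ≐ Φγ

  IsTriangle : R → R → R → Set
  IsTriangle r s t = r ≤ s ⊕ t × s ≤ r ⊕ t × t ≤ r ⊕ s

  NΔ-nonempty : ∀ {α β γ} → Approx α β γ → Set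
  NΔ-nonempty Φ = Σ R λ r → Σ R λ s → Σ R λ t →
    Σ (S r) λ sr → Σ (S s) λ ss → Σ (S t) λ st →
      ↑ r sr ∈I Approx.Φα Φ × ↑ s ss ∈I Approx.Φβ Φ × ↑ t st ∈I Approx.Φγ Φ ×
      IsTriangle r s t

-- Reading consistency as existence of a model, the triangle axioms of T_MS make the cuts of a
-- realized triangle triangle-closed in all three rotations; conversely such a cut triangle is
-- realized by a metric space on at most three points having the cuts as distances.
-- Triangle-closedness is equivalent to the approximation property: with γ the largest cut, closure
-- supplies a point of S above the left end of γ's interval and below r ⊕ s, which becomes the third
-- vertex; a failure of closure at r ∈ α, s ∈ β, t ∉ γ yields intervals below r, below s and above t
-- containing no triangle.  Part (b) is the case where γ is the larger of α and β.

module Submission where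

open import Defs
open import Level using (0ℓ; suc; lift; lower)
open import Data.Product using (_×_; Σ; _,_; proj₁; proj₂)
open import Data.Sum using (_⊎_; inj₁; inj₂)
open import Data.Empty using (⊥-elim)
open import Data.Unit using (⊤; tt)
open import Data.Bool using (Bool; true; false)
open import Function.Base using (_∘_)
open import Function.Bundles using (_⇔_; mk⇔)
open import Function.Construct.Composition using (_⇔-∘_)
open import Axiom.ExcludedMiddle using (ExcludedMiddle)
open import Relation.Nullary using (¬_; Dec; yes; no)
open import Relation.Nullary.Decidable using (map′; decidable-stable)
open import Relation.Binary.PropositionalEquality using (_≡_; refl; subst)
open import Relation.Binary.Structures using (IsTotalOrder)

module Development (lem : ExcludedMiddle (suc 0ℓ)) (𝓡 : DistanceMagma)
                   (S : DistanceMagma.Carrier 𝓡 → Set) (S0 : S (DistanceMagma.0# 𝓡)) where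
  open DistanceMagma 𝓡
  open Theory 𝓡 S
  open IsTotalOrder isTotalOrder using (total; antisym; reflexive)
    renaming (refl to ≤-refl; trans to ≤-trans)

  dec : (P : Set) → Dec P
  dec P = map′ lower lift lem

  dne : {P : Set} → ¬ ¬ P → P
  dne {P} = decidable-stable (dec P)

  ≰⇒≥ : ∀ {r s} → ¬ r ≤ s → s ≤ r
  ≰⇒≥ {r} {s} r≰s with total r s
  ... | inj₁ r≤s = ⊥-elim (r≰s r≤s)
  ... | inj₂ s≤r = s≤r

  <⇒≱ : ∀ {r s} → r < s → ¬ s ≤ r
  <⇒≱ (r≤s , r≢s) s≤r = r≢s (antisym r≤s s≤r)

  0#-minimum : ∀ r → 0# ≤ r
  0#-minimum r = subst (0# ≤_) (⊕-identityˡ r) (≤-⊕ 0# r)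

  ≤-⊕ʳ : ∀ r s → s ≤ r ⊕ s
  ≤-⊕ʳ r s = subst (s ≤_) (⊕-comm s r) (≤-⊕ s r)

  ≤-⊕-comm : ∀ {x r s} → x ≤ r ⊕ s → x ≤ s ⊕ r
  ≤-⊕-comm {x} {r} {s} = subst (x ≤_) (⊕-comm r s)

  _⊔_ : R → R → R
  r ⊔ s with total r s
  ... | inj₁ _ = s
  ... | inj₂ _ = r

  ⊔-pres : ∀ (P : R → Set) {r s} → P r → P s → P (r ⊔ s)
  ⊔-pres P {r} {s} pr ps with total r s
  ... | inj₁ _ = ps
  ... | inj₂ _ = pr

  ≤⊔ˡ : ∀ r s → r ≤ r ⊔ s
  ≤⊔ˡ r s with total r s
  ... | inj₁ r≤s = r≤s
  ... | inj₂ _ = ≤-refl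

  ≤⊔ʳ : ∀ r s → s ≤ r ⊔ s
  ≤⊔ʳ r s with total r s
  ... | inj₁ _ = ≤-refl
  ... | inj₂ s≤r = s≤r

  IsTriangle-apex : ∀ {r s t} → r ≤ t → s ≤ t → t ≤ r ⊕ s → IsTriangle r s t
  IsTriangle-apex {r} {s} {t} r≤t s≤t t≤r⊕s =
    ≤-trans r≤t (≤-⊕ʳ s t) , ≤-trans s≤t (≤-⊕ʳ r t) , t≤r⊕s

  IsTriangle-swap₁₂ : ∀ {r s t} → IsTriangle r s t → IsTriangle s r t
  IsTriangle-swap₁₂ (r≤ , s≤ , t≤) = s≤ , r≤ , ≤-⊕-comm t≤

  IsTriangle-swap₂₃ : ∀ {r s t} → IsTriangle r s t → IsTriangle r t s
  IsTriangle-swap₂₃ (r≤ , s≤ , t≤) = ≤-⊕-comm r≤ , t≤ , s≤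

  -- t bounds every element of S below r ⊕ s: the side condition of the triangle axiom of T_MS
  Bound : R → R → R → Set
  Bound r s t = ¬ (Σ R λ x → S x × t < x × x ≤ r ⊕ s)

  Bound⇒≤ : ∀ {r s t x} → Bound r s t → S x → x ≤ r ⊕ s → x ≤ t
  Bound⇒≤ {t = t} {x} b sx x≤r⊕s with total x t
  ... | inj₁ x≤t = x≤t
  ... | inj₂ t≤x with dec (t ≡ x)
  ...   | yes refl = ≤-refl
  ...   | no t≢x = ⊥-elim (b (x , sx , (t≤x , t≢x) , x≤r⊕s))

  ⊕≤⇒Bound : ∀ {r s t} → r ⊕ s ≤ t → Bound r s t
  ⊕≤⇒Bound r⊕s≤t (x , _ , t<x , x≤r⊕s) = <⇒≱ t<x (≤-trans x≤r⊕s r⊕s≤t)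

  Bound-comm : ∀ {r s t} → Bound r s t → Bound s r t
  Bound-comm b (x , sx , t<x , x≤s⊕r) = b (x , sx , t<x , ≤-⊕-comm x≤s⊕r)

  ≤*-refl : ∀ X → X ≤* X
  ≤*-refl X x x∈X = x∈X

  ≤*-trans : ∀ X Y Z → X ≤* Y → Y ≤* Z → X ≤* Z
  ≤*-trans X Y Z X≤Y Y≤Z x x∈Z = X≤Y x (Y≤Z x x∈Z)

  <*-≤*-trans : ∀ X Y Z → X <* Y → Y ≤* Z → X <* Z
  <*-≤*-trans X Y Z (X≤Y , Y≰X) Y≤Z = ≤*-trans X Y Z X≤Y Y≤Z , λ Z≤X → Y≰X (≤*-trans Y Z X Y≤Z Z≤X)

  ≤*-total : ∀ X Y → X ≤* Y ⊎ Y ≤* X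
  ≤*-total X Y with dec (X ≤* Y)
  ... | yes X≤Y = inj₁ X≤Y
  ... | no X≰Y = inj₂ Y≤X
    where
      -- some y ∈ Y lies outside X, so it is below every element of X
      witness : Σ R λ y → mem Y y × ¬ mem X y
      witness = dne λ none → X≰Y λ y y∈Y → dne λ y∉X → none (y , y∈Y , y∉X)
      Y≤X : Y ≤* X
      Y≤X x x∈X with witness
      ... | y , y∈Y , y∉X with total x y
      ...   | inj₁ x≤y = ⊥-elim (y∉X (upward X x y x∈X (mem⊆S Y y y∈Y) x≤y))
      ...   | inj₂ y≤x = upward Y y x y∈Y (mem⊆S X x x∈X) y≤x

  ≈*-refl : ∀ X → X ≈* X
  ≈*-refl X = ≤*-refl X , ≤*-refl X

  ≈*-sym : ∀ X Y → X ≈* Y → Y ≈* X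
  ≈*-sym X Y (X≤Y , Y≤X) = Y≤X , X≤Y

  ≤*-ωS : ∀ X → X ≤* ωS
  ≤*-ωS X = hasMax X

  ωS-≮* : ∀ X → ¬ ωS <* X
  ωS-≮* X (_ , X≰ωS) = X≰ωS (≤*-ωS X)

  ↑-mono : ∀ {u v} (su : S u) (sv : S v) → u ≤ v → ↑ u su ≤* ↑ v sv
  ↑-mono su sv u≤v x (sx , v≤x) = sx , ≤-trans u≤v v≤x

  ↑-cancel : ∀ {u v} (su : S u) (sv : S v) → ↑ u su ≤* ↑ v sv → u ≤ v
  ↑-cancel su sv ↑u≤↑v = proj₂ (↑u≤↑v _ (sv , ≤-refl))

  ≰⇒↑<* : ∀ {u v} (su : S u) (sv : S v) → ¬ v ≤ u → ↑ u su <* ↑ v sv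
  ≰⇒↑<* su sv v≰u = ↑-mono su sv (≰⇒≥ v≰u) , v≰u ∘ ↑-cancel sv su

  ↑<*⇒≰ : ∀ {u v} (su : S u) (sv : S v) → ↑ u su <* ↑ v sv → ¬ v ≤ u
  ↑<*⇒≰ su sv (_ , ↑v≰↑u) = ↑v≰↑u ∘ ↑-mono sv su

  mem⇒≤*↑ : ∀ X {u} (su : S u) → mem X u → X ≤* ↑ u su
  mem⇒≤*↑ X {u} su u∈X x (sx , u≤x) = upward X u x u∈X sx u≤x

  ≤*↑⇒mem : ∀ X {u} (su : S u) → X ≤* ↑ u su → mem X u
  ≤*↑⇒mem X su X≤↑u = X≤↑u _ (su , ≤-refl)

  ∉⇒↑<* : ∀ X {u} (su : S u) → ¬ mem X u → ↑ u su <* X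
  ∉⇒↑<* X {u} su u∉X = ↑u≤X , u∉X ∘ ≤*↑⇒mem X su
    where
      ↑u≤X : ↑ u su ≤* X
      ↑u≤X x x∈X = mem⊆S X x x∈X , ≰⇒≥ λ x≤u → u∉X (upward X x u x∈X su x≤u)

  ↑<*⇒∉ : ∀ X {u} (su : S u) → ↑ u su <* X → ¬ mem X u
  ↑<*⇒∉ X su (_ , X≰↑u) u∈X = X≰↑u (mem⇒≤*↑ X su u∈X)

  IsMaxS⇒ωS≤*↑ : ∀ {a} (sa : S a) → IsMaxS a → ωS ≤* ↑ a sa
  IsMaxS⇒ωS≤*↑ sa (_ , ≤a) x (sx , a≤x) = sx , λ y sy → ≤-trans (≤a y sy) a≤x

  ¬IsMaxS⇒above : ∀ {a} → S a → ¬ IsMaxS a → Σ R λ t → S t × ¬ t ≤ a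
  ¬IsMaxS⇒above sa ¬max = dne λ none → ¬max (sa , λ y sy → dne λ y≰a → none (y , sy , y≰a))

  Empty : Cut → Set
  Empty X = ∀ u → ¬ mem X u

  Empty⇒above : ∀ X → Empty X → ∀ {a} → S a → Σ R λ t → S t × ¬ t ≤ a
  Empty⇒above X empty sa = ¬IsMaxS⇒above sa λ max → empty _ (hasMax X _ max)

  𝟘 : Cut
  𝟘 = ↑ 0# S0

  0∈⇒≤* : ∀ X → mem X 0# → ∀ Y → X ≤* Y
  0∈⇒≤* X 0∈X Y y y∈Y = upward X 0# y 0∈X (mem⊆S Y y y∈Y) (0#-minimum y)

  0∈⇒𝟘≈* : ∀ X → mem X 0# → 𝟘 ≈* X
  0∈⇒𝟘≈* X 0∈X = (λ x x∈X → mem⊆S X x x∈X , 0#-minimum x) , 0∈⇒≤* X 0∈X 𝟘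

  Empty-≤* : ∀ X Y → X ≤* Y → Empty X → Empty Y
  Empty-≤* X Y X≤Y emptyX y y∈Y = emptyX y (X≤Y y y∈Y)

  -- What the triangle axioms force on cuts with d(x,y) ∈ A, d(y,z) ∈ B, d(x,z) ∈ C;
  -- IsCutTriangle is then the analogue of IsTriangle for cuts.
  TriangleClosed : Cut → Cut → Cut → Set
  TriangleClosed A B C = ∀ r s t → S t → Bound r s t → mem A r → mem B s → mem C t

  IsCutTriangle : Cut → Cut → Cut → Set
  IsCutTriangle α β γ = TriangleClosed β γ α × TriangleClosed α γ β × TriangleClosed α β γ

  TriangleClosed-comm : ∀ A B C → TriangleClosed A B C → TriangleClosed B A C
  TriangleClosed-comm A B C closed r s t st b s∈B r∈A = closed s r t st (Bound-comm b) r∈A s∈B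

  ≤*⇒TriangleClosedˡ : ∀ A B C → C ≤* A → TriangleClosed A B C
  ≤*⇒TriangleClosedˡ A B C C≤A r s t st b r∈A s∈B =
    upward C r t (C≤A r r∈A) st (Bound⇒≤ b (mem⊆S A r r∈A) (≤-⊕ r s))

  ≤*⇒TriangleClosedʳ : ∀ A B C → C ≤* B → TriangleClosed A B C
  ≤*⇒TriangleClosedʳ A B C C≤B =
    TriangleClosed-comm B A C (≤*⇒TriangleClosedˡ B A C C≤B)

  TriangleClosed-𝟘 : ∀ A B → TriangleClosed A B 𝟘
  TriangleClosed-𝟘 A B r s t st _ _ _ = st , 0#-minimum t

  0∈⇒TriangleClosed⇒≤*ʳ : ∀ A B C → mem A 0# → TriangleClosed A B C → C ≤* B
  0∈⇒TriangleClosed⇒≤*ʳ A B C 0∈A closed x x∈B =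
    closed 0# x x (mem⊆S B x x∈B) (⊕≤⇒Bound (reflexive (⊕-identityˡ x))) 0∈A x∈B

  0∈⇒TriangleClosed⇒≤*ˡ : ∀ A B C → mem B 0# → TriangleClosed A B C → C ≤* A
  0∈⇒TriangleClosed⇒≤*ˡ A B C 0∈B = 0∈⇒TriangleClosed⇒≤*ʳ B A C 0∈B ∘ TriangleClosed-comm A B C

  IsCutTriangle-maxˡ : ∀ α β → β ≤* α → IsCutTriangle α β α
  IsCutTriangle-maxˡ α β β≤α = ≤*⇒TriangleClosedʳ β α α (≤*-refl α)
                            , ≤*⇒TriangleClosedˡ α α β β≤α
                            , ≤*⇒TriangleClosedˡ α β α (≤*-refl α)

  IsCutTriangle-maxʳ : ∀ α β → α ≤* β → IsCutTriangle α β β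
  IsCutTriangle-maxʳ α β α≤β = ≤*⇒TriangleClosedˡ β β α α≤β
                            , ≤*⇒TriangleClosedʳ α β β (≤*-refl β)
                            , ≤*⇒TriangleClosedʳ α β β (≤*-refl β)

  module _ {𝓜 : LStructure} (isModel : IsModel 𝓜) where
    open LStructure 𝓜
    open IsModel isModel

    Realizes-sym : ∀ δ {u v} → Realizes 𝓜 δ u v → Realizes 𝓜 δ v u
    Realizes-sym δ {u} {v} real s ss =
        proj₁ (ax-symm s ss u v) ∘ proj₁ (real s ss)
      , λ ↑s<δ → proj₂ (real s ss) ↑s<δ ∘ proj₂ (ax-symm s ss u v)

    Realizes⇒D : ∀ δ {u v s} → Realizes 𝓜 δ u v → mem δ s → D s u v
    Realizes⇒D δ {s = s} real s∈δ = proj₁ (real s ss) (mem⇒≤*↑ δ ss s∈δ)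
      where ss = mem⊆S δ s s∈δ

    Realizes⇒mem : ∀ δ {u v s} → Realizes 𝓜 δ u v → S s → D s u v → mem δ s
    Realizes⇒mem δ real ss d = dne λ s∉δ → proj₂ (real _ ss) (∉⇒↑<* δ ss s∉δ) d

    Realizes⇒TriangleClosed : ∀ A B C {u v w} →
      Realizes 𝓜 A u v → Realizes 𝓜 B v w → Realizes 𝓜 C u w → TriangleClosed A B C
    Realizes⇒TriangleClosed A B C {u} {v} {w} realA realB realC r s t st b r∈A s∈B =
      Realizes⇒mem C realC st
        (ax-tri r s t (mem⊆S A r r∈A) (mem⊆S B s s∈B) st b u v w
          (Realizes⇒D A realA r∈A) (Realizes⇒D B realB s∈B))

  InΣ⇒IsCutTriangle : ∀ α β γ → InΣ α β γ → IsCutTriangle α β γ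
  InΣ⇒IsCutTriangle α β γ (𝓜 , isModel , x , y , z , realα , realβ , realγ) =
      Realizes⇒TriangleClosed isModel β γ α realβ (Realizes-sym isModel γ realγ)
                                                  (Realizes-sym isModel α realα)
    , Realizes⇒TriangleClosed isModel α γ β (Realizes-sym isModel α realα) realγ realβ
    , Realizes⇒TriangleClosed isModel α β γ realα realβ realγ

  record CutMetric : Set₁ where
    field
      Pt        : Set
      dist      : Pt → Pt → Cut
      dist-0    : ∀ u v → mem (dist u v) 0# → u ≡ v
      dist-refl : ∀ u → mem (dist u u) 0#
      dist-sym  : ∀ u v → dist v u ≤* dist u v
      dist-tri  : ∀ u v w → TriangleClosed (dist u v) (dist v w) (dist u w)

    structure : LStructure
    structure = record { Dom = Pt ; D = λ s u v → mem (dist u v) s }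

    isModel : IsModel structure
    isModel = record
      { ax-zero = λ u v → dist-0 u v , λ { refl → dist-refl u }
      ; ax-symm = λ s _ u v → dist-sym u v s , dist-sym v u s
      ; ax-tri  = λ r s t _ _ st b u v w → dist-tri u v w r s t st b
      ; ax-max  = λ m max u v → hasMax (dist u v) m max
      }

    realizes : ∀ δ {u v} → dist u v ≈* δ → Realizes structure δ u v
    realizes δ {u} {v} (d≤δ , δ≤d) s ss =
      (λ δ≤↑s → d≤δ s (≤*↑⇒mem δ ss δ≤↑s)) , (λ ↑s<δ → ↑<*⇒∉ δ ss ↑s<δ ∘ δ≤d s)

  module _ (M : CutMetric) where
    open CutMetric M

    CutMetric⇒InΣ : ∀ α β γ (x y z : Pt) → dist x y ≈* α → dist y z ≈* β → dist x z ≈* γ → InΣ α β γ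
    CutMetric⇒InΣ α β γ x y z xy yz xz =
      structure , isModel , x , y , z , realizes α xy , realizes β yz , realizes γ xz

  singleton : CutMetric
  singleton = record
    { Pt = ⊤ ; dist = λ _ _ → 𝟘 ; dist-0 = λ _ _ _ → refl ; dist-refl = λ _ → S0 , ≤-refl
    ; dist-sym = λ _ _ → ≤*-refl 𝟘 ; dist-tri = λ _ _ _ → TriangleClosed-𝟘 𝟘 𝟘 }

  module _ (δ : Cut) (0∉δ : ¬ mem δ 0#) where
    d₂ : Bool → Bool → Cut
    d₂ true  true  = 𝟘
    d₂ false false = 𝟘
    d₂ true  false = δ
    d₂ false true  = δ

    d₂-0 : ∀ u v → mem (d₂ u v) 0# → u ≡ v
    d₂-0 true  true  _ = refl
    d₂-0 false false _ = refl
    d₂-0 true  false 0∈δ = ⊥-elim (0∉δ 0∈δ)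
    d₂-0 false true  0∈δ = ⊥-elim (0∉δ 0∈δ)

    d₂-refl : ∀ u → mem (d₂ u u) 0#
    d₂-refl true  = S0 , ≤-refl
    d₂-refl false = S0 , ≤-refl

    d₂-sym : ∀ u v → d₂ v u ≤* d₂ u v
    d₂-sym true  true  = ≤*-refl 𝟘
    d₂-sym false false = ≤*-refl 𝟘
    d₂-sym true  false = ≤*-refl δ
    d₂-sym false true  = ≤*-refl δ

    d₂-tri : ∀ u v w → TriangleClosed (d₂ u v) (d₂ v w) (d₂ u w)
    d₂-tri true  true  true  = TriangleClosed-𝟘 𝟘 𝟘
    d₂-tri true  true  false = ≤*⇒TriangleClosedʳ 𝟘 δ δ (≤*-refl δ)
    d₂-tri true  false true  = TriangleClosed-𝟘 δ δ
    d₂-tri true  false false = ≤*⇒TriangleClosedˡ δ 𝟘 δ (≤*-refl δ)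
    d₂-tri false false false = TriangleClosed-𝟘 𝟘 𝟘
    d₂-tri false false true  = ≤*⇒TriangleClosedʳ 𝟘 δ δ (≤*-refl δ)
    d₂-tri false true  false = TriangleClosed-𝟘 δ δ
    d₂-tri false true  true  = ≤*⇒TriangleClosedˡ δ 𝟘 δ (≤*-refl δ)

    twoPoint : CutMetric
    twoPoint = record
      { Pt = Bool ; dist = d₂ ; dist-0 = d₂-0 ; dist-refl = d₂-refl ; dist-sym = d₂-sym ; dist-tri = d₂-tri }

  data Vertex : Set where
    X Y Z : Vertex

  module _ (α β γ : Cut) (0∉α : ¬ mem α 0#) (0∉β : ¬ mem β 0#) (0∉γ : ¬ mem γ 0#)
           (triangle : IsCutTriangle α β γ) where
    d₃ : Vertex → Vertex → Cut
    d₃ X X = 𝟘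
    d₃ Y Y = 𝟘
    d₃ Z Z = 𝟘
    d₃ X Y = α
    d₃ Y X = α
    d₃ Y Z = β
    d₃ Z Y = β
    d₃ X Z = γ
    d₃ Z X = γ

    d₃-0 : ∀ u v → mem (d₃ u v) 0# → u ≡ v
    d₃-0 X X _ = refl
    d₃-0 Y Y _ = refl
    d₃-0 Z Z _ = refl
    d₃-0 X Y 0∈α = ⊥-elim (0∉α 0∈α)
    d₃-0 Y X 0∈α = ⊥-elim (0∉α 0∈α)
    d₃-0 Y Z 0∈β = ⊥-elim (0∉β 0∈β)
    d₃-0 Z Y 0∈β = ⊥-elim (0∉β 0∈β)
    d₃-0 X Z 0∈γ = ⊥-elim (0∉γ 0∈γ)
    d₃-0 Z X 0∈γ = ⊥-elim (0∉γ 0∈γ)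

    d₃-refl : ∀ u → mem (d₃ u u) 0#
    d₃-refl X = S0 , ≤-refl
    d₃-refl Y = S0 , ≤-refl
    d₃-refl Z = S0 , ≤-refl

    d₃-sym : ∀ u v → d₃ v u ≤* d₃ u v
    d₃-sym X X = ≤*-refl 𝟘
    d₃-sym Y Y = ≤*-refl 𝟘
    d₃-sym Z Z = ≤*-refl 𝟘
    d₃-sym X Y = ≤*-refl α
    d₃-sym Y X = ≤*-refl α
    d₃-sym Y Z = ≤*-refl β
    d₃-sym Z Y = ≤*-refl β
    d₃-sym X Z = ≤*-refl γ
    d₃-sym Z X = ≤*-refl γ

    d₃-tri : ∀ u v w → TriangleClosed (d₃ u v) (d₃ v w) (d₃ u w)
    d₃-tri X X w = ≤*⇒TriangleClosedʳ 𝟘 (d₃ X w) (d₃ X w) (≤*-refl (d₃ X w))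
    d₃-tri Y Y w = ≤*⇒TriangleClosedʳ 𝟘 (d₃ Y w) (d₃ Y w) (≤*-refl (d₃ Y w))
    d₃-tri Z Z w = ≤*⇒TriangleClosedʳ 𝟘 (d₃ Z w) (d₃ Z w) (≤*-refl (d₃ Z w))
    d₃-tri X Y X = TriangleClosed-𝟘 α α
    d₃-tri X Y Y = ≤*⇒TriangleClosedˡ α 𝟘 α (≤*-refl α)
    d₃-tri X Y Z = proj₂ (proj₂ triangle)
    d₃-tri X Z X = TriangleClosed-𝟘 γ γ
    d₃-tri X Z Y = TriangleClosed-comm β γ α (proj₁ triangle)
    d₃-tri X Z Z = ≤*⇒TriangleClosedˡ γ 𝟘 γ (≤*-refl γ)
    d₃-tri Y X X = ≤*⇒TriangleClosedˡ α 𝟘 α (≤*-refl α)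
    d₃-tri Y X Y = TriangleClosed-𝟘 α α
    d₃-tri Y X Z = proj₁ (proj₂ triangle)
    d₃-tri Y Z X = proj₁ triangle
    d₃-tri Y Z Y = TriangleClosed-𝟘 β β
    d₃-tri Y Z Z = ≤*⇒TriangleClosedˡ β 𝟘 β (≤*-refl β)
    d₃-tri Z X X = ≤*⇒TriangleClosedˡ γ 𝟘 γ (≤*-refl γ)
    d₃-tri Z X Y = TriangleClosed-comm α γ β (proj₁ (proj₂ triangle))
    d₃-tri Z X Z = TriangleClosed-𝟘 γ γ
    d₃-tri Z Y X = TriangleClosed-comm α β γ (proj₂ (proj₂ triangle))
    d₃-tri Z Y Y = ≤*⇒TriangleClosedˡ β 𝟘 β (≤*-refl β)
    d₃-tri Z Y Z = TriangleClosed-𝟘 β β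

    threePoint : CutMetric
    threePoint = record
      { Pt = Vertex ; dist = d₃ ; dist-0 = d₃-0 ; dist-refl = d₃-refl ; dist-sym = d₃-sym ; dist-tri = d₃-tri }

  -- A cut containing 0 is a distance between equal points (axiom d(x,y) ≤ 0 ↔ x = y), so those cases
  -- need fewer than three points.
  IsCutTriangle⇒InΣ : ∀ α β γ → IsCutTriangle α β γ → InΣ α β γ
  IsCutTriangle⇒InΣ α β γ triangle@(βγα , αγβ , αβγ)
    with dec (mem α 0#) | dec (mem β 0#) | dec (mem γ 0#)
  ... | yes 0∈α | yes 0∈β | _ =
    CutMetric⇒InΣ singleton α β γ tt tt tt (0∈⇒𝟘≈* α 0∈α) (0∈⇒𝟘≈* β 0∈β) (0∈⇒𝟘≈* γ 0∈γ)
    where 0∈γ = 0∈⇒TriangleClosed⇒≤*ʳ α β γ 0∈α αβγ 0# 0∈β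
  ... | yes 0∈α | no 0∉β | _ =
    CutMetric⇒InΣ (twoPoint β 0∉β) α β γ true true false
      (0∈⇒𝟘≈* α 0∈α) (≈*-refl β)
      (0∈⇒TriangleClosed⇒≤*ʳ α γ β 0∈α αγβ , 0∈⇒TriangleClosed⇒≤*ʳ α β γ 0∈α αβγ)
  ... | no 0∉α | yes 0∈β | _ =
    CutMetric⇒InΣ (twoPoint α 0∉α) α β γ true false false
      (≈*-refl α) (0∈⇒𝟘≈* β 0∈β)
      (0∈⇒TriangleClosed⇒≤*ʳ β γ α 0∈β βγα , 0∈⇒TriangleClosed⇒≤*ˡ α β γ 0∈β αβγ)
  ... | no 0∉α | no 0∉β | yes 0∈γ =
    CutMetric⇒InΣ (twoPoint α 0∉α) α β γ true false true
      (≈*-refl α) (0∈⇒TriangleClosed⇒≤*ˡ β γ α 0∈γ βγα , 0∈⇒TriangleClosed⇒≤*ˡ α γ β 0∈γ αγβ)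
      (0∈⇒𝟘≈* γ 0∈γ)
  ... | no 0∉α | no 0∉β | no 0∉γ =
    CutMetric⇒InΣ (threePoint α β γ 0∉α 0∉β 0∉γ triangle) α β γ X Y Z (≈*-refl α) (≈*-refl β) (≈*-refl γ)

  _≤E_ : R → End → Set
  u ≤E fin b _ = u ≤ b
  u ≤E ω       = ⊤

  0#≤E : ∀ e → 0# ≤E e
  0#≤E (fin b _) = 0#-minimum b
  0#≤E ω         = tt

  ≤E⇒↑≤* : ∀ {u} (su : S u) e → u ≤E e → ↑ u su ≤* ⟦ e ⟧E
  ≤E⇒↑≤* su (fin b sb) u≤b = ↑-mono su sb u≤b
  ≤E⇒↑≤* su ω _            = ≤*-ωS (↑ _ su)

  infix 4 _∋_
  _∋_ : Int* → R → Set
  I ∋ u = Σ (S u) λ su → ↑ u su ∈I I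

  ∋-｛0｝ : ｛0｝ ∋ 0#
  ∋-｛0｝ = S0 , S0 , ≈*-refl 𝟘

  ∋-oc : ∀ {a} (sa : S a) b v {u} → S u → ¬ u ≤ a → u ≤E b → oc (fin a sa) b v ∋ u
  ∋-oc sa b v su u≰a u≤b = su , ≰⇒↑<* sa su u≰a , ≤E⇒↑≤* su b u≤b

  ∈｛0｝⇒0∈ : ∀ D → D ∈I ｛0｝ → mem D 0#
  ∈｛0｝⇒0∈ D (s0 , D≤↑0 , _) = ≤*↑⇒mem D s0 D≤↑0

  0∈⇒∋0 : ∀ D I → mem D 0# → D ∈I I → I ∋ 0#
  0∈⇒∋0 D ｛0｝ _ _ = ∋-｛0｝
  0∈⇒∋0 D (oc a b v) 0∈D (a<D , _) = ⊥-elim (proj₂ a<D (0∈⇒≤* D 0∈D ⟦ a ⟧E))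

  ∋-inhabited : ∀ I → Σ R (I ∋_)
  ∋-inhabited ｛0｝ = 0# , ∋-｛0｝
  ∋-inhabited (oc a (fin b sb) v) = b , sb , v , ≤*-refl (↑ b sb)
  ∋-inhabited (oc ω ω v) = ⊥-elim (ωS-≮* ωS v)
  ∋-inhabited (oc (fin a sa) ω v) with ¬IsMaxS⇒above sa (proj₂ v ∘ IsMaxS⇒ωS≤*↑ sa)
  ... | t , st , t≰a = t , ∋-oc sa ω v st t≰a tt

  ∋-eventually : ∀ D I → D ∈I I → Empty D → Σ R λ a → S a × (∀ {t} → S t → ¬ t ≤ a → I ∋ t)
  ∋-eventually D ｛0｝ D∈I empty = ⊥-elim (empty 0# (∈｛0｝⇒0∈ D D∈I))
  ∋-eventually D (oc ω b v) (ωS<D , _) _ = ⊥-elim (ωS-≮* D ωS<D)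
  ∋-eventually D (oc (fin a sa) (fin b sb) v) (_ , D≤↑b) empty = ⊥-elim (empty b (≤*↑⇒mem D sb D≤↑b))
  ∋-eventually D (oc (fin a sa) ω v) _ _ = a , sa , λ st t≰a → ∋-oc sa ω v st t≰a tt

  Empty⇒farPoint : ∀ A C IA IC → A ∈I IA → C ∈I IC → Empty A → Empty C → ∀ {s} → S s →
                   Σ R λ t → IA ∋ t × IC ∋ t × s ≤ t
  Empty⇒farPoint A C IA IC A∈IA C∈IC emptyA emptyC {s} ss
    with ∋-eventually A IA A∈IA emptyA | ∋-eventually C IC C∈IC emptyC
  ... | a , sa , IA∋ | c , sc , IC∋ with Empty⇒above A emptyA (⊔-pres S sa (⊔-pres S sc ss))
  ... | t , st , t≰M = t , IA∋ st (t≰M ∘ λ t≤a → ≤-trans t≤a a≤M) , IC∋ st (t≰M ∘ λ t≤c → ≤-trans t≤c c≤M)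
                     , ≤-trans s≤M (≰⇒≥ t≰M)
    where
      a≤M : a ≤ a ⊔ (c ⊔ s)
      a≤M = ≤⊔ˡ a (c ⊔ s)
      c≤M : c ≤ a ⊔ (c ⊔ s)
      c≤M = ≤-trans (≤⊔ˡ c s) (≤⊔ʳ a (c ⊔ s))
      s≤M : s ≤ a ⊔ (c ⊔ s)
      s≤M = ≤-trans (≤⊔ʳ c s) (≤⊔ʳ a (c ⊔ s))

  boundedElement : ∀ D b e → D ≤* ⟦ b ⟧E → D ≤* ⟦ e ⟧E →
                   (Σ R λ u → mem D u × u ≤E b × u ≤E e) ⊎ Empty D
  boundedElement D (fin b sb) (fin e se) D≤b D≤e with total b e
  ... | inj₁ b≤e = inj₁ (b , ≤*↑⇒mem D sb D≤b , ≤-refl , b≤e)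
  ... | inj₂ e≤b = inj₁ (e , ≤*↑⇒mem D se D≤e , e≤b , ≤-refl)
  boundedElement D (fin b sb) ω D≤b _ = inj₁ (b , ≤*↑⇒mem D sb D≤b , ≤-refl , tt)
  boundedElement D ω (fin e se) _ D≤e = inj₁ (e , ≤*↑⇒mem D se D≤e , tt , ≤-refl)
  boundedElement D ω ω _ _ with dec (Σ R (mem D))
  ... | yes (u , u∈D) = inj₁ (u , u∈D , tt , tt)
  ... | no none = inj₂ λ u u∈D → none (u , u∈D)

  ∋-element : ∀ D I e → D ∈I I → D ≤* ⟦ e ⟧E → (Σ R λ u → mem D u × I ∋ u × u ≤E e) ⊎ Empty D
  ∋-element D ｛0｝ e D∈I _ = inj₁ (0# , ∈｛0｝⇒0∈ D D∈I , ∋-｛0｝ , 0#≤E e)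
  ∋-element D (oc a b v) e (a<D , D≤b) D≤e with boundedElement D b e D≤b D≤e
  ... | inj₂ empty = inj₂ empty
  ... | inj₁ (u , u∈D , u≤b , u≤e) =
    inj₁ (u , u∈D , (su , <*-≤*-trans ⟦ a ⟧E D (↑ u su) a<D (mem⇒≤*↑ D su u∈D) , ≤E⇒↑≤* su b u≤b) , u≤e)
    where su = mem⊆S D u u∈D

  ∋-clamp : ∀ {c sc e v m y} → S y → ¬ y ≤ c → m ≤ y → m ≤E e →
            Σ R λ t → oc (fin c sc) e v ∋ t × m ≤ t × t ≤ y
  ∋-clamp {sc = sc} {ω} {v} sy y≰c m≤y _ = _ , ∋-oc sc ω v sy y≰c tt , m≤y , ≤-refl
  ∋-clamp {sc = sc} {fin e se} {v} {y = y} sy y≰c m≤y m≤e with total y e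
  ... | inj₁ y≤e = y , ∋-oc sc (fin e se) v sy y≰c y≤e , m≤y , ≤-refl
  ... | inj₂ e≤y = e , (se , v , ≤*-refl (↑ e se)) , m≤e , e≤y

  MeetsΔ : Int* → Int* → Int* → Set
  MeetsΔ I J K = Σ R λ r → Σ R λ s → Σ R λ t → I ∋ r × J ∋ s × K ∋ t × IsTriangle r s t

  MeetsΔ-swap₁₂ : ∀ I J K → MeetsΔ I J K → MeetsΔ J I K
  MeetsΔ-swap₁₂ I J K (r , s , t , I∋r , J∋s , K∋t , tri) =
    s , r , t , J∋s , I∋r , K∋t , IsTriangle-swap₁₂ tri

  MeetsΔ-swap₂₃ : ∀ I J K → MeetsΔ I J K → MeetsΔ I K J
  MeetsΔ-swap₂₃ I J K (r , s , t , I∋r , J∋s , K∋t , tri) =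
    r , t , s , I∋r , K∋t , J∋s , IsTriangle-swap₂₃ tri

  MeetsΔ-Emptyˡ : ∀ A C IA IB IC → A ∈I IA → C ∈I IC → Empty A → Empty C → MeetsΔ IA IB IC
  MeetsΔ-Emptyˡ A C IA IB IC A∈IA C∈IC emptyA emptyC with ∋-inhabited IB
  ... | s , IB∋s with Empty⇒farPoint A C IA IC A∈IA C∈IC emptyA emptyC (proj₁ IB∋s)
  ...   | t , IA∋t , IC∋t , s≤t = t , s , t , IA∋t , IB∋s , IC∋t , IsTriangle-apex ≤-refl s≤t (≤-⊕ t s)

  -- c ∉ C, so c does not bound r ⊕ s; the witness above c, raised above r ⊔ s and clamped into
  -- (c, e], is the apex
  MeetsΔ-nonempty : ∀ A B C IA IB {c} sc e v → C ∈I oc (fin c sc) e v → TriangleClosed A B C →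
                    ∀ {r s} → mem A r → mem B s → IA ∋ r → IB ∋ s → r ≤E e → s ≤E e →
                    MeetsΔ IA IB (oc (fin c sc) e v)
  MeetsΔ-nonempty A B C IA IB {c} sc e v (c<C , _) closed {r} {s} r∈A s∈B IA∋r IB∋s r≤e s≤e
    with dne (λ (b : Bound r s c) → ↑<*⇒∉ C sc c<C (closed r s c sc b r∈A s∈B))
  ... | x , sx , c<x , x≤r⊕s
    with ∋-clamp {sc = sc} {e} {v} (⊔-pres S sx (⊔-pres S (proj₁ IA∋r) (proj₁ IB∋s)))
                 (λ y≤c → <⇒≱ c<x (≤-trans (≤⊔ˡ x (r ⊔ s)) y≤c))
                 (≤⊔ʳ x (r ⊔ s)) (⊔-pres (_≤E e) r≤e s≤e)
  ... | t , IC∋t , r⊔s≤t , t≤y =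
    r , s , t , IA∋r , IB∋s , IC∋t ,
    IsTriangle-apex (≤-trans (≤⊔ˡ r s) r⊔s≤t) (≤-trans (≤⊔ʳ r s) r⊔s≤t)
      (≤-trans t≤y (⊔-pres (_≤ r ⊕ s) x≤r⊕s (⊔-pres (_≤ r ⊕ s) (≤-⊕ r s) (≤-⊕ʳ r s))))

  MeetsΔ-atMax : ∀ A B C IA IB IC → A ∈I IA → B ∈I IB → C ∈I IC → A ≤* C → B ≤* C →
                 TriangleClosed A B C → MeetsΔ IA IB IC
  MeetsΔ-atMax A B C IA IB ｛0｝ A∈IA B∈IB C∈IC A≤C B≤C _ =
    0# , 0# , 0# , 0∈⇒∋0 A IA (A≤C 0# 0∈C) A∈IA , 0∈⇒∋0 B IB (B≤C 0# 0∈C) B∈IB , ∋-｛0｝ ,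
    IsTriangle-apex ≤-refl ≤-refl (≤-⊕ 0# 0#)
    where 0∈C = ∈｛0｝⇒0∈ C C∈IC
  MeetsΔ-atMax A B C IA IB (oc ω e v) _ _ (ωS<C , _) _ _ _ = ⊥-elim (ωS-≮* C ωS<C)
  MeetsΔ-atMax A B C IA IB IC@(oc (fin c sc) e v) A∈IA B∈IB C∈IC@(_ , C≤e) A≤C B≤C closed
    with ∋-element A IA e A∈IA (≤*-trans A C ⟦ e ⟧E A≤C C≤e)
       | ∋-element B IB e B∈IB (≤*-trans B C ⟦ e ⟧E B≤C C≤e)
  ... | inj₂ emptyA | _ =
    MeetsΔ-Emptyˡ A C IA IB IC A∈IA C∈IC emptyA (Empty-≤* A C A≤C emptyA)
  ... | inj₁ _ | inj₂ emptyB =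
    MeetsΔ-swap₁₂ IB IA IC (MeetsΔ-Emptyˡ B C IB IA IC B∈IB C∈IC emptyB (Empty-≤* B C B≤C emptyB))
  ... | inj₁ (r , r∈A , IA∋r , r≤e) | inj₁ (s , s∈B , IB∋s , s≤e) =
    MeetsΔ-nonempty A B C IA IB sc e v C∈IC closed r∈A s∈B IA∋r IB∋s r≤e s≤e

  ≐-sym : ∀ I J → I ≐ J → J ≐ I
  ≐-sym I J I≐J x = proj₂ (I≐J x) , proj₁ (I≐J x)

  Approx-swap₁₂ : ∀ {α β γ} → Approx α β γ → Approx β α γ
  Approx-swap₁₂ {α} {β} Φ = record
    { Φα = Φβ ; Φβ = Φα ; Φγ = Φγ ; α∈ = β∈ ; β∈ = α∈ ; γ∈ = γ∈
    ; coh-αβ = ≐-sym Φα Φβ ∘ coh-αβ ∘ ≈*-sym β α ; coh-αγ = coh-βγ ; coh-βγ = coh-αγ }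
    where open Approx Φ

  Approx-swap₂₃ : ∀ {α β γ} → Approx α β γ → Approx α γ β
  Approx-swap₂₃ {β = β} {γ} Φ = record
    { Φα = Φα ; Φβ = Φγ ; Φγ = Φβ ; α∈ = α∈ ; β∈ = γ∈ ; γ∈ = β∈
    ; coh-αβ = coh-αγ ; coh-αγ = coh-αβ ; coh-βγ = ≐-sym Φβ Φγ ∘ coh-βγ ∘ ≈*-sym γ β }
    where open Approx Φ

  Approximable : Cut → Cut → Cut → Set₁
  Approximable α β γ = (Φ : Approx α β γ) → MeetsΔ (Approx.Φα Φ) (Approx.Φβ Φ) (Approx.Φγ Φ)

  Approximable-swap₁₂ : ∀ {α β γ} → Approximable α β γ → Approximable β α γ
  Approximable-swap₁₂ approximable Φ =
    MeetsΔ-swap₁₂ (Approx.Φβ Φ) (Approx.Φα Φ) (Approx.Φγ Φ) (approximable (Approx-swap₁₂ Φ))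

  Approximable-swap₂₃ : ∀ {α β γ} → Approximable α β γ → Approximable α γ β
  Approximable-swap₂₃ approximable Φ =
    MeetsΔ-swap₂₃ (Approx.Φα Φ) (Approx.Φγ Φ) (Approx.Φβ Φ) (approximable (Approx-swap₂₃ Φ))

  MeetsΔ⇒NΔ-nonempty : ∀ {α β γ} (Φ : Approx α β γ) →
                       MeetsΔ (Approx.Φα Φ) (Approx.Φβ Φ) (Approx.Φγ Φ) → NΔ-nonempty Φ
  MeetsΔ⇒NΔ-nonempty Φ (r , s , t , (sr , r∈) , (ss , s∈) , (st , t∈) , tri) =
    r , s , t , sr , ss , st , r∈ , s∈ , t∈ , tri

  NΔ-nonempty⇒MeetsΔ : ∀ {α β γ} (Φ : Approx α β γ) →
                       NΔ-nonempty Φ → MeetsΔ (Approx.Φα Φ) (Approx.Φβ Φ) (Approx.Φγ Φ)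
  NΔ-nonempty⇒MeetsΔ Φ (r , s , t , sr , ss , st , r∈ , s∈ , t∈ , tri) =
    r , s , t , (sr , r∈) , (ss , s∈) , (st , t∈) , tri

  Approximable⇔NΔ-nonempty : ∀ {α β γ} → Approximable α β γ ⇔ (∀ (Φ : Approx α β γ) → NΔ-nonempty Φ)
  Approximable⇔NΔ-nonempty = mk⇔ (λ approximable Φ → MeetsΔ⇒NΔ-nonempty Φ (approximable Φ))
                                 (λ nonempty Φ → NΔ-nonempty⇒MeetsΔ Φ (nonempty Φ))

  TriangleClosed⇒Approximable : ∀ α β γ → α ≤* γ → β ≤* γ → TriangleClosed α β γ → Approximable α β γ
  TriangleClosed⇒Approximable α β γ α≤γ β≤γ closed Φ =
    MeetsΔ-atMax α β γ Φα Φβ Φγ α∈ β∈ γ∈ α≤γ β≤γ closed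
    where open Approx Φ

  IsCutTriangle⇒Approximable : ∀ α β γ → IsCutTriangle α β γ → Approximable α β γ
  IsCutTriangle⇒Approximable α β γ (βγα , αγβ , αβγ) with ≤*-total α β
  ... | inj₁ α≤β with ≤*-total β γ
  ...   | inj₁ β≤γ = TriangleClosed⇒Approximable α β γ (≤*-trans α β γ α≤β β≤γ) β≤γ αβγ
  ...   | inj₂ γ≤β = Approximable-swap₂₃ (TriangleClosed⇒Approximable α γ β α≤β γ≤β αγβ)
  IsCutTriangle⇒Approximable α β γ (βγα , αγβ , αβγ) | inj₂ β≤α with ≤*-total α γ
  ...   | inj₁ α≤γ = TriangleClosed⇒Approximable α β γ α≤γ (≤*-trans β α γ β≤α α≤γ) αβγ
  ...   | inj₂ γ≤α =
    Approximable-swap₁₂ (Approximable-swap₂₃ (TriangleClosed⇒Approximable β γ α β≤α γ≤α βγα))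

  lowInterval : ∀ D {m} → S m → mem D m → Int*
  lowInterval D {m} sm m∈D with dec (mem D 0#)
  ... | yes _ = ｛0｝
  ... | no 0∉D = oc (fin 0# S0) (fin m sm) (≰⇒↑<* S0 sm λ m≤0 → 0∉D (upward D m 0# m∈D S0 m≤0))

  ∈lowInterval : ∀ D {m} (sm : S m) (m∈D : mem D m) → D ∈I lowInterval D sm m∈D
  ∈lowInterval D sm m∈D with dec (mem D 0#)
  ... | yes 0∈D = S0 , proj₂ (0∈⇒𝟘≈* D 0∈D) , proj₁ (0∈⇒𝟘≈* D 0∈D)
  ... | no 0∉D = ∉⇒↑<* D S0 0∉D , mem⇒≤*↑ D sm m∈D

  lowInterval-≤ : ∀ D {m} (sm : S m) (m∈D : mem D m) {u} → lowInterval D sm m∈D ∋ u → u ≤ m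
  lowInterval-≤ D {m} sm m∈D with dec (mem D 0#)
  ... | yes _ = λ (su , s0 , ↑u≤↑0 , _) → ≤-trans (↑-cancel su s0 ↑u≤↑0) (0#-minimum m)
  ... | no _ = λ (su , _ , ↑u≤↑m) → ↑-cancel su sm ↑u≤↑m

  lowInterval-≐ : ∀ A B {m} (sm sm′ : S m) (m∈A : mem A m) (m∈B : mem B m) → A ≈* B →
                  lowInterval A sm m∈A ≐ lowInterval B sm′ m∈B
  lowInterval-≐ A B sm sm′ m∈A m∈B (A≤B , B≤A) with dec (mem A 0#) | dec (mem B 0#)
  ... | yes _ | yes _ = λ _ → (λ x∈I → x∈I) , (λ x∈I → x∈I)
  ... | no _ | no _ = λ _ → (λ x∈I → x∈I) , (λ x∈I → x∈I)
  ... | yes 0∈A | no 0∉B = ⊥-elim (0∉B (B≤A 0# 0∈A))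
  ... | no 0∉A | yes 0∈B = ⊥-elim (0∉A (A≤B 0# 0∈B))

  -- a = b when α ≈* β, as the coherence condition on an S-approximation demands
  coherentLowerPoints : ∀ α β {r s} → mem α r → mem β s →
    Σ R λ a → Σ R λ b → mem α a × mem β b × a ≤ r × b ≤ s × (α ≈* β → a ≡ b)
  coherentLowerPoints α β {r} {s} r∈α s∈β with dec (α ≈* β)
  ... | no α≉β = r , s , r∈α , s∈β , ≤-refl , ≤-refl , ⊥-elim ∘ α≉β
  ... | yes (α≤β , β≤α) with total r s
  ...   | inj₁ r≤s = r , r , r∈α , β≤α r r∈α , ≤-refl , r≤s , λ _ → refl
  ...   | inj₂ s≤r = s , s , α≤β s s∈β , s∈β , s≤r , ≤-refl , λ _ → refl

  -- A triangle in N_Φ would have third side ≤ a ⊕ b ≤ r ⊕ s, hence ≤ t, yet Φγ = (t, ω]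
  violation⇒¬Approximable : ∀ α β γ {r s t} → S t → Bound r s t → mem α r → mem β s → ¬ mem γ t →
                            ¬ Approximable α β γ
  violation⇒¬Approximable α β γ {r} {s} {t} st bound r∈α s∈β t∉γ approximable
    with coherentLowerPoints α β r∈α s∈β
  ... | a , b , a∈α , b∈β , a≤r , b≤s , a≡b with approximable Φ
    where
      sa = mem⊆S α a a∈α
      sb = mem⊆S β b b∈β
      coh : α ≈* β → lowInterval α sa a∈α ≐ lowInterval β sb b∈β
      coh α≈β with a≡b α≈β
      ... | refl = lowInterval-≐ α β sa sb a∈α b∈β α≈β
      Φ : Approx α β γ
      Φ = record
        { Φα = lowInterval α sa a∈α ; Φβ = lowInterval β sb b∈β
        ; Φγ = oc (fin t st) ω (≤*-ωS (↑ t st) , λ ωS≤↑t → t∉γ (hasMax γ t (ωS≤↑t t (st , ≤-refl))))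
        ; α∈ = ∈lowInterval α sa a∈α ; β∈ = ∈lowInterval β sb b∈β ; γ∈ = ∉⇒↑<* γ st t∉γ , ≤*-ωS γ
        ; coh-αβ = coh
        ; coh-αγ = λ α≈γ → ⊥-elim (t∉γ (≤*⇒TriangleClosedˡ α β γ (proj₂ α≈γ) r s t st bound r∈α s∈β))
        ; coh-βγ = λ β≈γ → ⊥-elim (t∉γ (≤*⇒TriangleClosedʳ α β γ (proj₂ β≈γ) r s t st bound r∈α s∈β))
        }
  ... | r′ , s′ , t′ , ∋r′ , ∋s′ , (st′ , ↑t<↑t′ , _) , (_ , _ , t′≤r′⊕s′) =
    ↑<*⇒≰ st st′ ↑t<↑t′ (Bound⇒≤ bound st′ (≤-trans t′≤r′⊕s′ (⊕-mono
      (≤-trans (lowInterval-≤ α _ a∈α ∋r′) a≤r) (≤-trans (lowInterval-≤ β _ b∈β ∋s′) b≤s))))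

  Approximable⇒TriangleClosed : ∀ α β γ → Approximable α β γ → TriangleClosed α β γ
  Approximable⇒TriangleClosed α β γ approximable r s t st bound r∈α s∈β =
    dne λ t∉γ → violation⇒¬Approximable α β γ st bound r∈α s∈β t∉γ approximable

  Approximable⇒IsCutTriangle : ∀ α β γ → Approximable α β γ → IsCutTriangle α β γ
  Approximable⇒IsCutTriangle α β γ approximable =
      Approximable⇒TriangleClosed β γ α (Approximable-swap₂₃ (Approximable-swap₁₂ approximable))
    , Approximable⇒TriangleClosed α γ β (Approximable-swap₂₃ approximable)
    , Approximable⇒TriangleClosed α β γ approximable

  InΣ⇔Approximable : ∀ α β γ → InΣ α β γ ⇔ Approximable α β γ
  InΣ⇔Approximable α β γ =
    mk⇔ (IsCutTriangle⇒Approximable α β γ ∘ InΣ⇒IsCutTriangle α β γ)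
        (IsCutTriangle⇒InΣ α β γ ∘ Approximable⇒IsCutTriangle α β γ)

proposition2p11 : ExcludedMiddle (suc 0ℓ) →
    (𝓡 : DistanceMagma) (S : DistanceMagma.Carrier 𝓡 → Set) →
    S (DistanceMagma.0# 𝓡) →
    let open Theory 𝓡 S in
    (∀ (α β γ : Cut) → InΣ α β γ ⇔ (∀ (Φ : Approx α β γ) → NΔ-nonempty Φ))
    ×
    (∀ (α β : Cut) →
      (β ≤* α → InΣ α β α × (∀ σ → Is⊕* α β σ → α ≤* σ)) ×
      (α ≤* β → InΣ α β β × (∀ σ → Is⊕* α β σ → β ≤* σ)))
proposition2p11 lem 𝓡 S S0 =
  (λ α β γ → Approximable⇔NΔ-nonempty ⇔-∘ InΣ⇔Approximable α β γ) ,
  λ α β → (λ β≤α → belowSup α β α (IsCutTriangle⇒InΣ α β α (IsCutTriangle-maxˡ α β β≤α))) ,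
          (λ α≤β → belowSup α β β (IsCutTriangle⇒InΣ α β β (IsCutTriangle-maxʳ α β α≤β)))
  where
    open Development lem 𝓡 S S0
    open Theory 𝓡 S
    belowSup : ∀ α β γ → InΣ α β γ → InΣ α β γ × (∀ σ → Is⊕* α β σ → γ ≤* σ)
    belowSup α β γ γ∈Σ = γ∈Σ , λ σ σ-sup → proj₁ σ-sup γ γ∈Σ
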